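{- Let $L$ be a residuated lattice with $\mathrm{Rad}(L)=\{1\}$ and let $F$ be a filter of $L$. Then $F$ is an essential filter in $L$ if and only if $V_{Max}(F)$ is a nowhere dense subset of the topological space $Max(L)$.
   Context: A residuated lattice is an algebra $(L,\wedge,\vee,\odot,\rightarrow,0,1)$ such that $(L,\wedge,\vee,0,1)$ is a bounded lattice, $(L,\odot,1)$ is a commutative monoid, and $x\odot z\le y$ iff $z\le x\rightarrow y$. A filter is a nonempty subset closed under $\odot$ and upward closed. A filter $H$ is essential in $L$ if for every filter $G$ of $L$, $H\cap G=\{1\}$ implies $G=\{1\}$. $Max(L)$ is the set of maximal filters (proper filters not strictly contained in another proper filter); $\mathrm{Rad}(L)=\bigcap Max(L)$. For $A\subseteq L$, $U_{Max}(A):=\{M\in Max(L)\mid A\not\subseteq M\}$ and $V_{Max}(A):=Max(L)\setminus U_{Max}(A)$; the sets $U_{Max}(A)$ ($A\subseteq L$) are the open sets of a topology on $Max(L)$. A subset is nowhere dense if its closure has empty interior. -}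

module Defs where

open import Level using (0ℓ; Lift)
open import Data.Product using (Σ; ∃; _×_; _,_; proj₁)
open import Relation.Nullary using (¬_)
open import Relation.Binary.PropositionalEquality using (_≡_)
open import Algebra.Core using (Op₂)
open import Algebra.Lattice.Structures using (IsLattice)
open import Algebra.Structures using (IsCommutativeMonoid)

record ResiduatedLattice : Set₁ where
  infixr 6 _∨_
  infixr 7 _∧_
  infixr 7 _⊙_
  infixr 5 _⇒_
  infix 4 _≤_
  field
    Carrier : Set
    _∧_ _∨_ _⊙_ _⇒_ : Op₂ Carrier
    𝟘 𝟙 : Carrier
    isLattice : IsLattice _≡_ _∨_ _∧_
  _≤_ : Carrier → Carrier → Set
  x ≤ y = x ∧ y ≡ x
  field
    𝟘-least : ∀ x → 𝟘 ≤ x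
    𝟙-greatest : ∀ x → x ≤ 𝟙
    ⊙-isCommutativeMonoid : IsCommutativeMonoid _≡_ _⊙_ 𝟙
    residuation-⇒ : ∀ x y z → x ⊙ z ≤ y → z ≤ x ⇒ y
    residuation-⇐ : ∀ x y z → z ≤ x ⇒ y → x ⊙ z ≤ y

module _ (L : ResiduatedLattice) where
  open ResiduatedLattice L

  Subset : Set₁
  Subset = Carrier → Set

  _⊆_ : Subset → Subset → Set
  A ⊆ B = ∀ x → A x → B x

  record IsFilter (F : Subset) : Set where
    field
      nonempty : ∃ λ x → F x
      ⊙-closed : ∀ x y → F x → F y → F (x ⊙ y)
      up-closed : ∀ x y → F x → x ≤ y → F y

  -- a filter is trivial ("= {1}"): it contains only 1 (1 belongs to every filter)
  IsTrivial : Subset → Set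
  IsTrivial G = ∀ x → G x → x ≡ 𝟙

  Proper : Subset → Set
  Proper F = ¬ (∀ x → F x)

  IsMaximal : Subset → Set₁
  IsMaximal M = IsFilter M × Proper M ×
    (∀ G → IsFilter G → Proper G → M ⊆ G → G ⊆ M)

  IsEssential : Subset → Set₁
  IsEssential H = ∀ G → IsFilter G →
    IsTrivial (λ x → H x × G x) → IsTrivial G

  Max : Set₁
  Max = Σ Subset IsMaximal

  Rad : Carrier → Set₁
  Rad x = ∀ (M : Max) → proj₁ M x

  MaxSubset : Set₂
  MaxSubset = Max → Set₁

  U-Max : Subset → MaxSubset
  U-Max A M = Lift _ (¬ (A ⊆ proj₁ M))

  V-Max : Subset → MaxSubset
  V-Max A M = Lift _ (A ⊆ proj₁ M)

  IsOpen : MaxSubset → Set₁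
  IsOpen S = ∃ λ (A : Subset) → ∀ M → (S M → U-Max A M) × (U-Max A M → S M)

  interior : MaxSubset → MaxSubset
  interior S M = ∃ λ (A : Subset) → U-Max A M × (∀ N → U-Max A N → S N)

  closure : MaxSubset → MaxSubset
  closure S M = ∀ (A : Subset) → U-Max A M → ∃ λ N → U-Max A N × S N

  IsNowhereDense : MaxSubset → Set₁
  IsNowhereDense S = ∀ M → ¬ interior (closure S) M

{-# OPTIONS --safe #-}
-- A maximal filter N that does not contain a filter F contains an m with m ⊙ f ≤ 𝟘 for
-- some f ∈ F, since otherwise N and F would generate a proper filter strictly above N.
-- Hence if F ∩ G = {𝟙}, every maximal filter contains F or G: annihilators m₁ of f ∈ F
-- and m₂ of g ∈ G give m₁ ⊙ m₂ ⊙ (f ∨ g) ≤ 𝟘, where f ∨ g ∈ F ∩ G is 𝟙.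
-- So U(G) ⊆ V(F), and as V(F) is closed, nowhere density makes U(G) empty, i.e.
-- G ⊆ Rad(L) = {𝟙}. Conversely, if M ∈ U(A) ⊆ V(F), take a ∈ A outside M: every maximal
-- filter contains a or F, so ⟨a⟩ ∩ F ⊆ Rad(L) = {𝟙}, and essentiality gives a = 𝟙 ∈ M.
module Submission where

open import Defs
open import Level using (0ℓ; lift; lower)
open import Data.Nat using (ℕ; zero; suc; _+_)
open import Data.Product using (_×_; _,_; proj₁; ∃)
open import Relation.Nullary using (¬_)
open import Relation.Nullary.Decidable using (map′)
open import Relation.Binary.PropositionalEquality using (_≡_; sym; trans; cong; subst)
open import Axiom.ExcludedMiddle using (ExcludedMiddle)
open import Axiom.DoubleNegationElimination using (em⇒dne)
open import Algebra.Bundles using (CommutativeMonoid)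
open import Algebra.Lattice.Bundles using (Lattice)
open import Algebra.Lattice.Properties.Lattice using (∨-∧-orderTheoreticLattice)
import Algebra.Properties.CommutativeSemigroup as CommutativeSemigroupProperties
import Algebra.Properties.Monoid.Mult as MonoidMult
import Relation.Binary.Lattice as OrderTheoretic

module ResiduatedLatticeProperties (L : ResiduatedLattice) where
  open ResiduatedLattice L

  private
    lattice : Lattice 0ℓ 0ℓ
    lattice = record { isLattice = isLattice }

    ⊙-commutativeMonoid : CommutativeMonoid 0ℓ 0ℓ
    ⊙-commutativeMonoid = record { isCommutativeMonoid = ⊙-isCommutativeMonoid }

    module O = OrderTheoretic.Lattice (∨-∧-orderTheoreticLattice lattice)

  open CommutativeMonoid ⊙-commutativeMonoid public using ()
    renaming (assoc to ⊙-assoc; comm to ⊙-comm; identityˡ to ⊙-identityˡ; identityʳ to ⊙-identityʳ)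
  open CommutativeSemigroupProperties (CommutativeMonoid.commutativeSemigroup ⊙-commutativeMonoid)
    public using (interchange; xy∙z≈y∙xz)
  open MonoidMult (CommutativeMonoid.monoid ⊙-commutativeMonoid)
    using (×-homo-+) renaming (_×_ to _×ᵐ_)

  -- Defs orders by x ∧ y ≡ x; the library's natural order of a lattice is x ≡ x ∧ y.
  ≤-reflexive : ∀ {x y} → x ≡ y → x ≤ y
  ≤-reflexive p = sym (O.reflexive p)

  ≤-refl : ∀ {x} → x ≤ x
  ≤-refl = sym O.refl

  ≤-trans : ∀ {x y z} → x ≤ y → y ≤ z → x ≤ z
  ≤-trans p q = sym (O.trans (sym p) (sym q))

  x≤x∨y : ∀ x y → x ≤ x ∨ y
  x≤x∨y x y = sym (O.x≤x∨y x y)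

  y≤x∨y : ∀ x y → y ≤ x ∨ y
  y≤x∨y x y = sym (O.y≤x∨y x y)

  ∨-least : ∀ {x y z} → x ≤ z → y ≤ z → x ∨ y ≤ z
  ∨-least p q = sym (O.∨-least (sym p) (sym q))

  ⊙-monoʳ-≤ : ∀ z {x y} → x ≤ y → z ⊙ x ≤ z ⊙ y
  ⊙-monoʳ-≤ z {x} {y} x≤y =
    residuation-⇐ z (z ⊙ y) x (≤-trans x≤y (residuation-⇒ z (z ⊙ y) y ≤-refl))

  ⊙-monoˡ-≤ : ∀ z {x y} → x ≤ y → x ⊙ z ≤ y ⊙ z
  ⊙-monoˡ-≤ z {x} {y} x≤y = subst (λ t → t ≤ y ⊙ z) (⊙-comm z x)
    (subst (λ t → z ⊙ x ≤ t) (⊙-comm z y) (⊙-monoʳ-≤ z x≤y))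

  ⊙-mono-≤ : ∀ {x y u v} → x ≤ y → u ≤ v → x ⊙ u ≤ y ⊙ v
  ⊙-mono-≤ {y = y} {u = u} x≤y u≤v = ≤-trans (⊙-monoˡ-≤ u x≤y) (⊙-monoʳ-≤ y u≤v)

  x⊙y≤y : ∀ x y → x ⊙ y ≤ y
  x⊙y≤y x y = subst (λ t → x ⊙ y ≤ t) (⊙-identityˡ y) (⊙-monoˡ-≤ y (𝟙-greatest x))

  ⊙-∨-least : ∀ {x y z w} → x ⊙ y ≤ w → x ⊙ z ≤ w → x ⊙ (y ∨ z) ≤ w
  ⊙-∨-least {x} {y} {z} {w} xy≤w xz≤w = residuation-⇐ x w (y ∨ z)
    (∨-least (residuation-⇒ x w y xy≤w) (residuation-⇒ x w z xz≤w))

  _^_ : Carrier → ℕ → Carrier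
  a ^ n = n ×ᵐ a

  _⊆ₗ_ : Subset L → Subset L → Set
  _⊆ₗ_ = _⊆_ L

  𝟙∈filter : ∀ {F} → IsFilter L F → F 𝟙
  𝟙∈filter isF = let x , x∈F = nonempty in up-closed x 𝟙 x∈F (𝟙-greatest x)
    where open IsFilter isF

  ^∈filter : ∀ {F a} → IsFilter L F → F a → ∀ n → F (a ^ n)
  ^∈filter isF a∈F zero    = 𝟙∈filter isF
  ^∈filter isF a∈F (suc n) = IsFilter.⊙-closed isF _ _ a∈F (^∈filter isF a∈F n)

  proper⇒𝟘∉ : ∀ {F} → IsFilter L F → Proper L F → ¬ F 𝟘
  proper⇒𝟘∉ isF proper 𝟘∈F = proper (λ x → IsFilter.up-closed isF 𝟘 x 𝟘∈F (𝟘-least x))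

  ⟨_⟩ : Carrier → Subset L
  ⟨ a ⟩ x = ∃ λ n → a ^ n ≤ x

  ⟨⟩-isFilter : ∀ a → IsFilter L ⟨ a ⟩
  ⟨⟩-isFilter a = record
    { nonempty  = 𝟙 , 0 , ≤-refl
    ; ⊙-closed  = λ x y (m , aᵐ≤x) (n , aⁿ≤y) →
        m + n , subst (_≤ x ⊙ y) (sym (×-homo-+ a m n)) (⊙-mono-≤ aᵐ≤x aⁿ≤y)
    ; up-closed = λ x y (n , aⁿ≤x) x≤y → n , ≤-trans aⁿ≤x x≤y
    }

  a∈⟨a⟩ : ∀ a → ⟨ a ⟩ a
  a∈⟨a⟩ a = 1 , ≤-reflexive (⊙-identityʳ a)

  ⟨⟩-least : ∀ {F a} → IsFilter L F → F a → ⟨ a ⟩ ⊆ₗ F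
  ⟨⟩-least isF a∈F x (n , aⁿ≤x) = IsFilter.up-closed isF _ x (^∈filter isF a∈F n) aⁿ≤x

  _∨ᶠ_ : Subset L → Subset L → Subset L
  (A ∨ᶠ B) x = ∃ λ a → ∃ λ b → A a × B b × a ⊙ b ≤ x

  ∨ᶠ-isFilter : ∀ {A B} → IsFilter L A → IsFilter L B → IsFilter L (A ∨ᶠ B)
  ∨ᶠ-isFilter isA isB = record
    { nonempty  = 𝟙 ⊙ 𝟙 , 𝟙 , 𝟙 , 𝟙∈filter isA , 𝟙∈filter isB , ≤-refl
    ; ⊙-closed  = λ x y (a , b , a∈A , b∈B , ab≤x) (a′ , b′ , a′∈A , b′∈B , a′b′≤y) →
        a ⊙ a′ , b ⊙ b′ ,
        IsFilter.⊙-closed isA _ _ a∈A a′∈A , IsFilter.⊙-closed isB _ _ b∈B b′∈B ,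
        subst (_≤ x ⊙ y) (interchange a b a′ b′) (⊙-mono-≤ ab≤x a′b′≤y)
    ; up-closed = λ x y (a , b , a∈A , b∈B , ab≤x) x≤y → a , b , a∈A , b∈B , ≤-trans ab≤x x≤y
    }

  ⊆-∨ᶠˡ : ∀ {A B} → IsFilter L B → A ⊆ₗ (A ∨ᶠ B)
  ⊆-∨ᶠˡ isB x x∈A = x , 𝟙 , x∈A , 𝟙∈filter isB , ≤-reflexive (⊙-identityʳ x)

  ⊆-∨ᶠʳ : ∀ {A B} → IsFilter L A → B ⊆ₗ (A ∨ᶠ B)
  ⊆-∨ᶠʳ isA x x∈B = 𝟙 , x , 𝟙∈filter isA , x∈B , ≤-reflexive (⊙-identityˡ x)

  ⊆-closure : ∀ {S : MaxSubset L} M → S M → closure L S M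
  ⊆-closure M M∈S A M∈U[A] = M , M∈U[A] , M∈S

module ClassicalProperties
  (em : ExcludedMiddle (Level.suc (Level.suc 0ℓ))) (L : ResiduatedLattice) where
  open ResiduatedLattice L
  open ResiduatedLatticeProperties L

  dne : {P : Set} → ¬ ¬ P → P
  dne = em⇒dne (map′ lower lift em)

  ⊈-maximal⇒annihilating : ∀ {N F} → IsMaximal L N → IsFilter L F → ¬ F ⊆ₗ N →
                           ∃ λ m → ∃ λ f → N m × F f × m ⊙ f ≤ 𝟘
  ⊈-maximal⇒annihilating (isN , _ , maximal) isF F⊈N = dne λ 𝟘∉N∨ᶠF →
    F⊈N λ x x∈F →
      maximal _ (∨ᶠ-isFilter isN isF) (λ all → 𝟘∉N∨ᶠF (all 𝟘)) (⊆-∨ᶠˡ isF) x (⊆-∨ᶠʳ isN x x∈F)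

  maximal-⊇-of-trivial-meet : ∀ {N F G} → IsMaximal L N → IsFilter L F → IsFilter L G →
                              IsTrivial L (λ x → F x × G x) → ¬ G ⊆ₗ N → F ⊆ₗ N
  maximal-⊇-of-trivial-meet maxN@(isN , properN , _) isF isG trivial G⊈N = dne λ F⊈N →
    let m₁ , f , m₁∈N , f∈F , m₁f≤𝟘 = ⊈-maximal⇒annihilating maxN isF F⊈N
        m₂ , g , m₂∈N , g∈G , m₂g≤𝟘 = ⊈-maximal⇒annihilating maxN isG G⊈N
        f∨g≡𝟙 = trivial (f ∨ g) ( IsFilter.up-closed isF _ _ f∈F (x≤x∨y f g)
                                , IsFilter.up-closed isG _ _ g∈G (y≤x∨y f g))
        mf≤𝟘 = subst (_≤ 𝟘) (sym (xy∙z≈y∙xz m₁ m₂ f)) (≤-trans (x⊙y≤y m₂ _) m₁f≤𝟘)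
        mg≤𝟘 = subst (_≤ 𝟘) (sym (⊙-assoc m₁ m₂ g)) (≤-trans (x⊙y≤y m₁ _) m₂g≤𝟘)
        m≤𝟘 = subst (_≤ 𝟘) (trans (cong ((m₁ ⊙ m₂) ⊙_) f∨g≡𝟙) (⊙-identityʳ _))
                (⊙-∨-least mf≤𝟘 mg≤𝟘)
        m∈N = IsFilter.⊙-closed isN _ _ m₁∈N m₂∈N
    in proper⇒𝟘∉ isN properN (IsFilter.up-closed isN _ 𝟘 m∈N m≤𝟘)

  V-Max-closed : ∀ F M → closure L (V-Max L F) M → V-Max L F M
  V-Max-closed F M M∈closure = lift (dne λ F⊈M →
    let _ , lift F⊈N , lift F⊆N = M∈closure F (lift F⊈M) in F⊈N F⊆N)

  module _ (rad-trivial : ∀ x → Rad L x → x ≡ 𝟙) {F : Subset L} where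

    essential⇒≡𝟙 : IsEssential L F → ∀ a →
                   (∀ (N : Max L) → ¬ proj₁ N a → F ⊆ₗ proj₁ N) → a ≡ 𝟙
    essential⇒≡𝟙 essential a F⊆avoiding =
      essential ⟨ a ⟩ (⟨⟩-isFilter a) meet-trivial a (a∈⟨a⟩ a)
      where
        meet-trivial : IsTrivial L (λ x → F x × ⟨ a ⟩ x)
        meet-trivial x (x∈F , x∈⟨a⟩) = rad-trivial x λ N@(_ , isN , _) → dne λ x∉N →
          x∉N (F⊆avoiding N (λ a∈N → x∉N (⟨⟩-least isN a∈N x x∈⟨a⟩)) x x∈F)

    essential⇒nowhereDense : IsEssential L F → IsNowhereDense L (V-Max L F)
    essential⇒nowhereDense essential M@(_ , isM , _) (A , lift A⊈M , U[A]⊆closureV) =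
      A⊈M λ a a∈A → dne λ a∉M → a∉M (subst (proj₁ M) (sym (a≡𝟙 a a∈A)) (𝟙∈filter isM))
      where
        a≡𝟙 : ∀ a → A a → a ≡ 𝟙
        a≡𝟙 a a∈A = essential⇒≡𝟙 essential a λ N a∉N →
          lower (V-Max-closed F N (U[A]⊆closureV N (lift λ A⊆N → a∉N (A⊆N a a∈A))))

    nowhereDense⇒essential : IsFilter L F → IsNowhereDense L (V-Max L F) → IsEssential L F
    nowhereDense⇒essential isF nowhereDense G isG trivial x x∈G =
      rad-trivial x λ M → dne λ x∉M →
        nowhereDense M (G , lift (λ G⊆M → x∉M (G⊆M x x∈G)) , U[G]⊆closureV)
      where
        U[G]⊆closureV : ∀ N → U-Max L G N → closure L (V-Max L F) N
        U[G]⊆closureV N@(_ , maxN) (lift G⊈N) =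
          ⊆-closure N (lift (maximal-⊇-of-trivial-meet maxN isF isG trivial G⊈N))

theorem2p17 : ExcludedMiddle (Level.suc (Level.suc 0ℓ)) →
    (L : ResiduatedLattice) →
    (∀ x → Rad L x → x ≡ ResiduatedLattice.𝟙 L) →
    (F : Subset L) → IsFilter L F →
    ((IsEssential L F → IsNowhereDense L (V-Max L F)) ×
     (IsNowhereDense L (V-Max L F) → IsEssential L F))
theorem2p17 em L rad-trivial F isF =
  essential⇒nowhereDense rad-trivial , nowhereDense⇒essential rad-trivial isF
  where open ClassicalProperties em L
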